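{- The set species $\mathrm{SF}$ of grounded set families admits the structure of a commutative (connected) Hopf monoid in set species, with product given by join, $\mathcal{F}_1\cdot\mathcal{F}_2=\mathcal{F}_1*\mathcal{F}_2$, and coproduct given, for each decomposition $I=S\sqcup T$, by $\Delta_{S,T}(\mathcal{F})=(\mathcal{F}|_S,\ \mathcal{F}/_S)$.
   Context: A grounded set family on a finite set $I$ is a pair $(\mathcal{F},I)$ with $\mathcal{F}\subseteq 2^I$ and $\emptyset\in\mathcal{F}$; elements of $I$ lying in no member of $\mathcal{F}$ are allowed (they are called phantoms). The set species $\mathrm{SF}$ sends a finite set $I$ to the set $\mathrm{SF}[I]$ of grounded set families on $I$, and a bijection $I\to J$ to the induced relabeling. For disjoint $I_1,I_2$, the join is $(\mathcal{F}_1,I_1)*(\mathcal{F}_2,I_2)=(\{X\cup Y: X\in\mathcal{F}_1,\ Y\in\mathcal{F}_2\},\ I_1\cup I_2)$. For $I=S\sqcup T$, the restriction is $\mathcal{F}|_S=\{F\cap S: F\in\mathcal{F}\}$ with ground set $S$, and the contraction is $\mathcal{F}/_S=\{F\in\mathcal{F}: F\cap S=\emptyset\}$ with ground set $T$. A Hopf monoid in set species (in the sense of Aguiar–Mahajan) is a functor $\mathrm{H}$ from finite sets with bijections to sets together with maps $\mu_{S,T}:\mathrm{H}[S]\times\mathrm{H}[T]\to\mathrm{H}[I]$ and $\Delta_{S,T}:\mathrm{H}[I]\to\mathrm{H}[S]\times\mathrm{H}[T]$ for every decomposition $I=S\sqcup T$, satisfying the axioms of naturality, unitality, associativity, coassociativity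 and compatibility; it is connected if $|\mathrm{H}[\emptyset]|=1$, and commutative if $\mu_{S,T}(x,y)=\mu_{T,S}(y,x)$. -}

module Defs where

open import Level using (Level; _⊔_) renaming (suc to lsuc; zero to lzero)
open import Data.Nat using (ℕ; _≟_)
open import Data.Bool using (Bool; true; false; _∧_; _∨_)
open import Data.Bool.Properties using (∧-zeroʳ)
open import Data.List using (List; [])
open import Data.List.Membership.Propositional using (_∈_)
open import Data.List.Membership.DecPropositional _≟_ using (_∈?_)
open import Relation.Nullary.Decidable using (⌊_⌋)
open import Data.Product using (Σ; _×_; _,_; proj₁; proj₂)
open import Data.Sum using (_⊎_)
open import Data.Empty using (⊥)
open import Relation.Binary.Structures using (IsEquivalence)
open import Relation.Binary.PropositionalEquality
  using (_≡_; refl; sym; trans; cong₂)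

-- A finite set is represented by a finite list of labels (natural
-- numbers); it denotes the set of its entries.  (Every finite set is in
-- bijection with a finite set of naturals, so the category of such
-- finite sets with bijections is equivalent to the category of all
-- finite sets with bijections.)

FinSet : Set
FinSet = List ℕ

record Partition (I S T : FinSet) : Set where
  field
    cover : ∀ i → i ∈ I → (i ∈ S) ⊎ (i ∈ T)
    S⊆I   : ∀ i → i ∈ S → i ∈ I
    T⊆I   : ∀ i → i ∈ T → i ∈ I
    disj  : ∀ i → i ∈ S → i ∈ T → ⊥

record Bij (I J : FinSet) : Set where
  field
    to      : ℕ → ℕ
    from    : ℕ → ℕ
    to-∈    : ∀ i → i ∈ I → to i ∈ J
    from-∈  : ∀ j → j ∈ J → from j ∈ I
    from-to : ∀ i → i ∈ I → from (to i) ≡ i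
    to-from : ∀ j → j ∈ J → to (from j) ≡ j

open Bij public

-- Set species: the data (values are setoids, since Agda has no quotients; the
-- equality of H[I] is the setoid equality _≈_).

record SetSpecies (a ℓ : Level) : Set (lsuc (a ⊔ ℓ)) where
  field
    H        : FinSet → Set a
    _≈_      : ∀ {I} → H I → H I → Set ℓ
    relabel  : ∀ {I J} → Bij I J → H I → H J

-- laws of a set species (setoid equivalence, well-definedness, functoriality;
-- two bijections are identified when they agree on I)
record IsSetSpecies {a ℓ : Level} (Sp : SetSpecies a ℓ) : Set (a ⊔ ℓ) where
  open SetSpecies Sp
  field
    isEquiv  : ∀ {I} → IsEquivalence (_≈_ {I})
    relabel-cong : ∀ {I J} (σ : Bij I J) {x y : H I} → x ≈ y →
                   relabel σ x ≈ relabel σ y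
    relabel-id : ∀ {I} (σ : Bij I I) → (∀ i → i ∈ I → to σ i ≡ i) →
                 ∀ x → relabel σ x ≈ x
    relabel-∘  : ∀ {I J K} (σ : Bij I J) (τ : Bij J K) (ρ : Bij I K) →
                 (∀ i → i ∈ I → to ρ i ≡ to τ (to σ i)) →
                 ∀ x → relabel ρ x ≈ relabel τ (relabel σ x)

module _ {a ℓ : Level} (Sp : SetSpecies a ℓ) where
  open SetSpecies Sp

  Product : Set a
  Product = ∀ {I S T} → Partition I S T → H S → H T → H I

  Coproduct : Set a
  Coproduct = ∀ {I S T} → Partition I S T → H I → H S × H T

  -- Hopf monoid (bimonoid axioms) in set species, in the sense of
  -- Aguiar–Mahajan, with unit e ∈ H[∅].
  record IsHopfMonoid (μ : Product) (Δ : Coproduct) (e : H []) : Set (a ⊔ ℓ) where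
    field
      -- well-definedness on setoids / independence of the proof of I = S ⊔ T
      μ-cong : ∀ {I S T} (p q : Partition I S T) {x x' y y'} →
               x ≈ x' → y ≈ y' → μ p x y ≈ μ q x' y'
      Δ-cong : ∀ {I S T} (p q : Partition I S T) {x x'} → x ≈ x' →
               (proj₁ (Δ p x) ≈ proj₁ (Δ q x')) × (proj₂ (Δ p x) ≈ proj₂ (Δ q x'))
      μ-natural : ∀ {I S T J S' T'} (p : Partition I S T) (p' : Partition J S' T')
                  (σ : Bij I J) (σS : Bij S S') (σT : Bij T T') →
                  (∀ i → i ∈ S → to σS i ≡ to σ i) →
                  (∀ i → i ∈ T → to σT i ≡ to σ i) →
                  ∀ x y → relabel σ (μ p x y) ≈ μ p' (relabel σS x) (relabel σT y)
      Δ-natural : ∀ {I S T J S' T'} (p : Partition I S T) (p' : Partition J S' T')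
                  (σ : Bij I J) (σS : Bij S S') (σT : Bij T T') →
                  (∀ i → i ∈ S → to σS i ≡ to σ i) →
                  (∀ i → i ∈ T → to σT i ≡ to σ i) →
                  ∀ x → (relabel σS (proj₁ (Δ p x)) ≈ proj₁ (Δ p' (relabel σ x)))
                      × (relabel σT (proj₂ (Δ p x)) ≈ proj₂ (Δ p' (relabel σ x)))
      unitʳ : ∀ {I} (p : Partition I I []) x → μ p x e ≈ x
      unitˡ : ∀ {I} (p : Partition I [] I) x → μ p e x ≈ x
      counitʳ : ∀ {I} (p : Partition I I []) x → proj₁ (Δ p x) ≈ x
      counitˡ : ∀ {I} (p : Partition I [] I) x → proj₂ (Δ p x) ≈ x
      assoc : ∀ {I R S T RS ST}
              (p₁ : Partition RS R S) (p₂ : Partition I RS T)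
              (q₁ : Partition ST S T) (q₂ : Partition I R ST) →
              ∀ x y z → μ p₂ (μ p₁ x y) z ≈ μ q₂ x (μ q₁ y z)
      coassoc : ∀ {I R S T RS ST}
              (p₁ : Partition RS R S) (p₂ : Partition I RS T)
              (q₁ : Partition ST S T) (q₂ : Partition I R ST) →
              ∀ w →
                (proj₁ (Δ p₁ (proj₁ (Δ p₂ w))) ≈ proj₁ (Δ q₂ w))
              × (proj₂ (Δ p₁ (proj₁ (Δ p₂ w))) ≈ proj₁ (Δ q₁ (proj₂ (Δ q₂ w))))
              × (proj₂ (Δ p₂ w) ≈ proj₂ (Δ q₁ (proj₂ (Δ q₂ w))))
      -- compatibility: I = S ⊔ T = S' ⊔ T', with A = S∩S', B = S∩T',
      -- C = T∩S', D = T∩T'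
      compat : ∀ {I S T S' T' A B C D}
               (P : Partition I S T) (P' : Partition I S' T')
               (pS : Partition S A B) (pT : Partition T C D)
               (pS' : Partition S' A C) (pT' : Partition T' B D) →
               ∀ x y →
                 (proj₁ (Δ P' (μ P x y)) ≈ μ pS' (proj₁ (Δ pS x)) (proj₁ (Δ pT y)))
               × (proj₂ (Δ P' (μ P x y)) ≈ μ pT' (proj₂ (Δ pS x)) (proj₂ (Δ pT y)))

  IsConnected : Set (a ⊔ ℓ)
  IsConnected = Σ (H []) λ e₀ → ∀ x → x ≈ e₀

  IsCommutative : Product → Set (a ⊔ ℓ)
  IsCommutative μ = ∀ {I S T} (p : Partition I S T) (q : Partition I T S) →
                    ∀ x y → μ p x y ≈ μ q y x

-- Grounded set families.
-- A subset of I is given by a characteristic function on labels; only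
-- its values on I matter.

Sub : Set
Sub = ℕ → Bool

∅ₛ : Sub
∅ₛ _ = false

_≐[_]_ : Sub → FinSet → Sub → Set
X ≐[ I ] Y = ∀ i → i ∈ I → X i ≡ Y i

_∩[_] : Sub → FinSet → Sub
(X ∩[ S ]) i = ⌊ i ∈? S ⌋ ∧ X i

record SFam (I : FinSet) : Set₁ where
  field
    mem      : Sub → Set
    mem-resp : ∀ X Y → X ≐[ I ] Y → mem X → mem Y
    grounded : mem ∅ₛ
open SFam public

_≈SF_ : ∀ {I} → SFam I → SFam I → Set
F ≈SF G = ∀ X → (mem F X → mem G X) × (mem G X → mem F X)

-- induced relabeling: σ(𝓕) = { σ(X) : X ∈ 𝓕 },  where j ∈ σ(X) iff σ⁻¹(j) ∈ X
relabelSF : ∀ {I J} → Bij I J → SFam I → SFam J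
relabelSF {I} {J} σ F = record
  { mem      = λ Z → Σ Sub λ X → mem F X × (∀ j → j ∈ J → Z j ≡ X (from σ j))
  ; mem-resp = λ Z Z' e (X , m , q) → X , m , λ j jJ → trans (sym (e j jJ)) (q j jJ)
  ; grounded = ∅ₛ , grounded F , λ _ _ → refl
  }

-- join  𝓕₁ * 𝓕₂ = { X ∪ Y : X ∈ 𝓕₁, Y ∈ 𝓕₂ }  on I = S ⊔ T
joinSF : ∀ {I S T} → Partition I S T → SFam S → SFam T → SFam I
joinSF {I} {S} {T} _ F₁ F₂ = record
  { mem      = λ Z → Σ Sub λ X → Σ Sub λ Y → mem F₁ X × mem F₂ Y ×
                     (∀ i → i ∈ I → Z i ≡ ((X ∩[ S ]) i ∨ (Y ∩[ T ]) i))
  ; mem-resp = λ Z Z' e (X , Y , m₁ , m₂ , q) →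
                 X , Y , m₁ , m₂ , λ i iI → trans (sym (e i iI)) (q i iI)
  ; grounded = ∅ₛ , ∅ₛ , grounded F₁ , grounded F₂ ,
               λ i _ → sym (cong₂ _∨_ (∧-zeroʳ ⌊ i ∈? S ⌋) (∧-zeroʳ ⌊ i ∈? T ⌋))
  }

-- restriction  𝓕|_S = { F ∩ S : F ∈ 𝓕 }  (ground set S)
restrictSF : ∀ {I S T} → Partition I S T → SFam I → SFam S
restrictSF {I} {S} _ F = record
  { mem      = λ Z → Σ Sub λ X → mem F X × (∀ i → i ∈ S → Z i ≡ (X ∩[ S ]) i)
  ; mem-resp = λ Z Z' e (X , m , q) → X , m , λ i iS → trans (sym (e i iS)) (q i iS)
  ; grounded = ∅ₛ , grounded F , λ i _ → sym (∧-zeroʳ ⌊ i ∈? S ⌋)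
  }

-- contraction  𝓕/_S = { F ∈ 𝓕 : F ∩ S = ∅ }  (ground set T)
contractSF : ∀ {I S T} → Partition I S T → SFam I → SFam T
contractSF {I} {S} {T} _ F = record
  { mem      = λ Z → Σ Sub λ X → mem F X × (∀ i → i ∈ S → X i ≡ false)
                                         × (∀ i → i ∈ T → Z i ≡ X i)
  ; mem-resp = λ Z Z' e (X , m , d , q) →
                 X , m , d , λ i iT → trans (sym (e i iT)) (q i iT)
  ; grounded = ∅ₛ , grounded F , (λ _ _ → refl) , (λ _ _ → refl)
  }

SF : SetSpecies (lsuc lzero) lzero
SF = record
  { H        = SFam
  ; _≈_      = _≈SF_
  ; relabel  = relabelSF
  }

μSF : Product SF
μSF = joinSF

ΔSF : Coproduct SF
ΔSF p F = restrictSF p F , contractSF p F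

module Submission where

-- A subset of I = S ⊔ T is determined by its traces on S and on T, and the
-- traces of X ∪ Y are X and Y.  Join, restriction and contraction are described
-- by traces, and relabelling transports traces along bijections that agree on
-- the blocks, so each Hopf monoid axiom reduces to comparing traces on the
-- blocks of a common refinement of the decompositions involved.

open import Defs
open import Level using (0ℓ)
open import Function using (_∘_; id)
open import Data.Nat using (_≟_)
open import Data.Bool using (false; _∨_)
open import Data.Bool.Properties using (∨-comm; ∨-identityʳ)
open import Data.Empty using (⊥-elim)
open import Data.List using ([])
open import Data.List.Membership.Propositional using (_∈_; _∉_)
open import Data.List.Membership.DecPropositional _≟_ using (_∈?_)
open import Data.Product using (Σ; _×_; _,_; proj₁; proj₂; swap)
open import Data.Sum using (inj₁; inj₂)
open import Data.Unit using (⊤; tt)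
open import Relation.Nullary using (yes; no)
open import Relation.Binary.Bundles using (Setoid)
open import Relation.Binary.Structures using (IsEquivalence)
open import Relation.Binary.PropositionalEquality
  using (_≡_; refl; sym; trans; cong; cong₂; subst; module ≡-Reasoning)
import Relation.Binary.Reasoning.Setoid as SetoidReasoning

open Partition

≐-refl : ∀ {S X} → X ≐[ S ] X
≐-refl _ _ = refl

≐-sym : ∀ {S X Y} → X ≐[ S ] Y → Y ≐[ S ] X
≐-sym X≐Y i i∈S = sym (X≐Y i i∈S)

≐-trans : ∀ {S X Y Z} → X ≐[ S ] Y → Y ≐[ S ] Z → X ≐[ S ] Z
≐-trans X≐Y Y≐Z i i∈S = trans (X≐Y i i∈S) (Y≐Z i i∈S)

≐-setoid : FinSet → Setoid 0ℓ 0ℓ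
≐-setoid S = record
  { Carrier       = Sub
  ; _≈_           = _≐[ S ]_
  ; isEquivalence = record { refl = ≐-refl ; sym = ≐-sym ; trans = ≐-trans }
  }

module ≐-Reasoning (S : FinSet) = SetoidReasoning (≐-setoid S)

≐-mono : ∀ {S I X Y} → (∀ i → i ∈ S → i ∈ I) → X ≐[ I ] Y → X ≐[ S ] Y
≐-mono S⊆I X≐Y i i∈S = X≐Y i (S⊆I i i∈S)

∩-∈ : ∀ {S} X {i} → i ∈ S → (X ∩[ S ]) i ≡ X i
∩-∈ {S} X {i} i∈S with i ∈? S
... | yes _   = refl
... | no i∉S = ⊥-elim (i∉S i∈S)

∩-∉ : ∀ {S} X {i} → i ∉ S → (X ∩[ S ]) i ≡ false
∩-∉ {S} X {i} i∉S with i ∈? S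
... | yes i∈S = ⊥-elim (i∉S i∈S)
... | no _    = refl

∩-≐ : ∀ {S} X → (X ∩[ S ]) ≐[ S ] X
∩-≐ X _ = ∩-∈ X

∩-resp-≐ : ∀ {S X Y} → X ≐[ S ] Y → ∀ i → (X ∩[ S ]) i ≡ (Y ∩[ S ]) i
∩-resp-≐ {S} X≐Y i with i ∈? S
... | yes i∈S = X≐Y i i∈S
... | no _    = refl

infix 25 _∪[_,_]_

_∪[_,_]_ : Sub → FinSet → FinSet → Sub → Sub
(X ∪[ S , T ] Y) i = (X ∩[ S ]) i ∨ (Y ∩[ T ]) i

∪-comm : ∀ {I S T} X Y → X ∪[ S , T ] Y ≐[ I ] Y ∪[ T , S ] X
∪-comm {S = S} {T} X Y i _ = ∨-comm ((X ∩[ S ]) i) ((Y ∩[ T ]) i)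

∪-resp-≐ : ∀ {I S T X X' Y Y'} → X ≐[ S ] X' → Y ≐[ T ] Y' →
           X ∪[ S , T ] Y ≐[ I ] X' ∪[ S , T ] Y'
∪-resp-≐ X≐X' Y≐Y' i _ = cong₂ _∨_ (∩-resp-≐ X≐X' i) (∩-resp-≐ Y≐Y' i)

module _ {I S T} (p : Partition I S T) where

  ∪-≐ˡ : ∀ X Y → X ∪[ S , T ] Y ≐[ S ] X
  ∪-≐ˡ X Y i i∈S =
    trans (cong₂ _∨_ (∩-∈ X i∈S) (∩-∉ Y (disj p i i∈S))) (∨-identityʳ (X i))

  ∪-≐ʳ : ∀ X Y → X ∪[ S , T ] Y ≐[ T ] Y
  ∪-≐ʳ X Y i i∈T = cong₂ _∨_ (∩-∉ X (λ i∈S → disj p i i∈S i∈T)) (∩-∈ Y i∈T)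

  ≐-by-parts : ∀ {X Y} → X ≐[ S ] Y → X ≐[ T ] Y → X ≐[ I ] Y
  ≐-by-parts X≐ˢY X≐ᵀY i i∈I with cover p i i∈I
  ... | inj₁ i∈S = X≐ˢY i i∈S
  ... | inj₂ i∈T = X≐ᵀY i i∈T

∪-refine : ∀ {I S T S' A C} → Partition I S T → Partition S' A C →
           (∀ i → i ∈ A → i ∈ S) → (∀ i → i ∈ C → i ∈ T) →
           ∀ X Y → X ∪[ S , T ] Y ≐[ S' ] X ∪[ A , C ] Y
∪-refine P p A⊆S C⊆T X Y = ≐-by-parts p
  (≐-trans (≐-mono A⊆S (∪-≐ˡ P X Y)) (≐-sym (∪-≐ˡ p X Y)))
  (≐-trans (≐-mono C⊆T (∪-≐ʳ P X Y)) (≐-sym (∪-≐ʳ p X Y)))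

∪-assoc : ∀ {I R S T RS ST}
          (p₁ : Partition RS R S) (p₂ : Partition I RS T)
          (q₁ : Partition ST S T) (q₂ : Partition I R ST) → ∀ {X Y Z W V} →
          W ≐[ RS ] X ∪[ R , S ] Y → V ≐[ ST ] Y ∪[ S , T ] Z →
          W ∪[ RS , T ] Z ≐[ I ] X ∪[ R , ST ] V
∪-assoc {I} {R} {S} {T} {RS} {ST} p₁ p₂ q₁ q₂ {X} {Y} {Z} {W} {V} W≐ V≐ =
  ≐-by-parts p₂ (≐-by-parts p₁ onR onS) onT
  where
  onR : W ∪[ RS , T ] Z ≐[ R ] X ∪[ R , ST ] V
  onR = begin
    W ∪[ RS , T ] Z  ≈⟨ ≐-mono (S⊆I p₁) (∪-≐ˡ p₂ W Z) ⟩
    W                ≈⟨ ≐-mono (S⊆I p₁) W≐ ⟩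
    X ∪[ R , S ] Y   ≈⟨ ∪-≐ˡ p₁ X Y ⟩
    X                ≈⟨ ∪-≐ˡ q₂ X V ⟨
    X ∪[ R , ST ] V  ∎
    where open ≐-Reasoning R
  onS : W ∪[ RS , T ] Z ≐[ S ] X ∪[ R , ST ] V
  onS = begin
    W ∪[ RS , T ] Z  ≈⟨ ≐-mono (T⊆I p₁) (∪-≐ˡ p₂ W Z) ⟩
    W                ≈⟨ ≐-mono (T⊆I p₁) W≐ ⟩
    X ∪[ R , S ] Y   ≈⟨ ∪-≐ʳ p₁ X Y ⟩
    Y                ≈⟨ ∪-≐ˡ q₁ Y Z ⟨
    Y ∪[ S , T ] Z   ≈⟨ ≐-mono (S⊆I q₁) V≐ ⟨
    V                ≈⟨ ≐-mono (S⊆I q₁) (∪-≐ʳ q₂ X V) ⟨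
    X ∪[ R , ST ] V  ∎
    where open ≐-Reasoning S
  onT : W ∪[ RS , T ] Z ≐[ T ] X ∪[ R , ST ] V
  onT = begin
    W ∪[ RS , T ] Z  ≈⟨ ∪-≐ʳ p₂ W Z ⟩
    Z                ≈⟨ ∪-≐ʳ q₁ Y Z ⟨
    Y ∪[ S , T ] Z   ≈⟨ ≐-mono (T⊆I q₁) V≐ ⟨
    V                ≈⟨ ≐-mono (T⊆I q₁) (∪-≐ʳ q₂ X V) ⟨
    X ∪[ R , ST ] V  ∎
    where open ≐-Reasoning T

from-unique : ∀ {I J} (σ : Bij I J) {i j} → i ∈ I → to σ i ≡ j → from σ j ≡ i
from-unique σ i∈I refl = from-to σ _ i∈I

from-id : ∀ {I} (σ : Bij I I) → (∀ i → i ∈ I → to σ i ≡ i) →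
          ∀ i → i ∈ I → from σ i ≡ i
from-id σ σ≗id i i∈I = from-unique σ i∈I (σ≗id i i∈I)

from-∘ : ∀ {I J K} (σ : Bij I J) (τ : Bij J K) (ρ : Bij I K) →
         (∀ i → i ∈ I → to ρ i ≡ to τ (to σ i)) →
         ∀ k → k ∈ K → from ρ k ≡ from σ (from τ k)
from-∘ {J = J} σ τ ρ ρ≗τσ k k∈K = from-unique ρ (from-∈ σ _ j∈J) (begin
    to ρ (from σ (from τ k))        ≡⟨ ρ≗τσ _ (from-∈ σ _ j∈J) ⟩
    to τ (to σ (from σ (from τ k))) ≡⟨ cong (to τ) (to-from σ _ j∈J) ⟩
    to τ (from τ k)                 ≡⟨ to-from τ k k∈K ⟩
    k                               ∎)
  where
  open ≡-Reasoning
  j∈J : from τ k ∈ J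
  j∈J = from-∈ τ k k∈K

∘from-resp-≐ : ∀ {I J} (σ : Bij I J) {X Y} → X ≐[ I ] Y → (X ∘ from σ) ≐[ J ] (Y ∘ from σ)
∘from-resp-≐ σ X≐Y j j∈J = X≐Y (from σ j) (from-∈ σ j j∈J)

module Agreement {I J S S'} (σ : Bij I J) (σS : Bij S S')
                 (S⊆I : ∀ i → i ∈ S → i ∈ I)
                 (agree : ∀ i → i ∈ S → to σS i ≡ to σ i) where

  from-agree : ∀ j → j ∈ S' → from σ j ≡ from σS j
  from-agree j j∈S' =
    from-unique σ (S⊆I _ i∈S) (trans (sym (agree _ i∈S)) (to-from σS j j∈S'))
    where
    i∈S : from σS j ∈ S
    i∈S = from-∈ σS j j∈S'

  transport-≐ : ∀ {X Y} → X ≐[ S ] Y → (X ∘ from σS) ≐[ S' ] (Y ∘ from σ)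
  transport-≐ {Y = Y} X≐Y j j∈S' =
    trans (X≐Y _ (from-∈ σS j j∈S')) (cong Y (sym (from-agree j j∈S')))

  transport-reflects-≐ : ∀ {X Y} → (X ∘ from σ) ≐[ S' ] (Y ∘ from σ) → X ≐[ S ] Y
  transport-reflects-≐ {X} {Y} X≐Y i i∈S =
    subst (λ k → X k ≡ Y k) (from-unique σ (S⊆I i i∈S) (sym (agree i i∈S)))
          (X≐Y (to σS i) (to-∈ σS i i∈S))

≈SF-isEquivalence : ∀ {I} → IsEquivalence (_≈SF_ {I})
≈SF-isEquivalence = record
  { refl  = λ _ → id , id
  ; sym   = λ F≈G X → swap (F≈G X)
  ; trans = λ F≈G G≈H X → proj₁ (G≈H X) ∘ proj₁ (F≈G X) , proj₂ (F≈G X) ∘ proj₂ (G≈H X)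
  }

relabelSF-cong : ∀ {I J} (σ : Bij I J) {F G} → F ≈SF G → relabelSF σ F ≈SF relabelSF σ G
relabelSF-cong σ F≈G Z = (λ (X , m , e) → X , proj₁ (F≈G X) m , e)
                       , (λ (X , m , e) → X , proj₂ (F≈G X) m , e)

relabelSF-id : ∀ {I} (σ : Bij I I) → (∀ i → i ∈ I → to σ i ≡ i) →
               ∀ F → relabelSF σ F ≈SF F
relabelSF-id {I} σ σ≗id F Z =
    (λ (X , m , Z≐X∘σ⁻¹) → mem-resp F X Z (≐-sym (≐-trans Z≐X∘σ⁻¹ (∘σ⁻¹≐ X))) m)
  , (λ m → Z , m , ≐-sym (∘σ⁻¹≐ Z))
  where
  ∘σ⁻¹≐ : ∀ X → (X ∘ from σ) ≐[ I ] X
  ∘σ⁻¹≐ X i i∈I = cong X (from-id σ σ≗id i i∈I)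

relabelSF-∘ : ∀ {I J K} (σ : Bij I J) (τ : Bij J K) (ρ : Bij I K) →
              (∀ i → i ∈ I → to ρ i ≡ to τ (to σ i)) →
              ∀ F → relabelSF ρ F ≈SF relabelSF τ (relabelSF σ F)
relabelSF-∘ σ τ ρ ρ≗τσ F Z =
    (λ (X , m , Z≐) → X ∘ from σ , (X , m , ≐-refl) ,
        ≐-trans Z≐ (λ k k∈K → cong X (from-∘ σ τ ρ ρ≗τσ k k∈K)))
  , (λ (Y , (X , m , Y≐) , Z≐) → X , m ,
        ≐-trans Z≐ (≐-trans (∘from-resp-≐ τ Y≐) (λ k k∈K → cong X (sym (from-∘ σ τ ρ ρ≗τσ k k∈K)))))

SF-isSetSpecies : IsSetSpecies SF
SF-isSetSpecies = record
  { isEquiv      = ≈SF-isEquivalence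
  ; relabel-cong = relabelSF-cong
  ; relabel-id   = relabelSF-id
  ; relabel-∘    = relabelSF-∘
  }

-- On the empty ground set every subset is ∅, so the family {∅} is the total predicate.
unitSF : SFam []
unitSF = record { mem = λ _ → ⊤ ; mem-resp = λ _ _ _ _ → tt ; grounded = tt }

SF-connected : IsConnected SF
SF-connected = unitSF , λ F Z → (λ _ → tt) , (λ _ → mem-resp F ∅ₛ Z (λ _ ()) (grounded F))

joinSF-cong : ∀ {I S T} (p q : Partition I S T) {F F' G G'} → F ≈SF F' → G ≈SF G' →
              joinSF p F G ≈SF joinSF q F' G'
joinSF-cong p q F≈F' G≈G' Z =
    (λ (X , Y , mX , mY , e) → X , Y , proj₁ (F≈F' X) mX , proj₁ (G≈G' Y) mY , e)
  , (λ (X , Y , mX , mY , e) → X , Y , proj₂ (F≈F' X) mX , proj₂ (G≈G' Y) mY , e)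

restrictSF-cong : ∀ {I S T} (p q : Partition I S T) {F F'} → F ≈SF F' →
                  restrictSF p F ≈SF restrictSF q F'
restrictSF-cong p q F≈F' Z = (λ (X , m , e) → X , proj₁ (F≈F' X) m , e)
                           , (λ (X , m , e) → X , proj₂ (F≈F' X) m , e)

contractSF-cong : ∀ {I S T} (p q : Partition I S T) {F F'} → F ≈SF F' →
                  contractSF p F ≈SF contractSF q F'
contractSF-cong p q F≈F' Z = (λ (X , m , d , e) → X , proj₁ (F≈F' X) m , d , e)
                           , (λ (X , m , d , e) → X , proj₂ (F≈F' X) m , d , e)

joinSF-comm : IsCommutative SF μSF
joinSF-comm {S = S} {T} p q F G Z =
    (λ (X , Y , mX , mY , e) → Y , X , mY , mX , ≐-trans e (∪-comm {S = S} {T} X Y))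
  , (λ (Y , X , mY , mX , e) → X , Y , mX , mY , ≐-trans e (∪-comm {S = T} {S} Y X))

joinSF-identityʳ : ∀ {I} (p : Partition I I []) F → joinSF p F unitSF ≈SF F
joinSF-identityʳ p F Z =
    (λ (X , Y , m , _ , e) → mem-resp F X Z (≐-sym (≐-trans e (∪-≐ˡ p X Y))) m)
  , (λ m → Z , ∅ₛ , m , tt , ≐-sym (∪-≐ˡ p Z ∅ₛ))

joinSF-identityˡ : ∀ {I} (p : Partition I [] I) F → joinSF p unitSF F ≈SF F
joinSF-identityˡ p F Z =
    (λ (X , Y , _ , m , e) → mem-resp F Y Z (≐-sym (≐-trans e (∪-≐ʳ p X Y))) m)
  , (λ m → ∅ₛ , Z , tt , m , ≐-sym (∪-≐ʳ p ∅ₛ Z))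

restrictSF-identity : ∀ {I} (p : Partition I I []) F → restrictSF p F ≈SF F
restrictSF-identity p F Z =
    (λ (X , m , e) → mem-resp F X Z (≐-sym (≐-trans e (∩-≐ X))) m)
  , (λ m → Z , m , ≐-sym (∩-≐ Z))

contractSF-identity : ∀ {I} (p : Partition I [] I) F → contractSF p F ≈SF F
contractSF-identity p F Z = (λ (X , m , _ , e) → mem-resp F X Z (≐-sym e) m)
                          , (λ m → Z , m , (λ _ ()) , ≐-refl)

joinSF-assoc : ∀ {I R S T RS ST}
               (p₁ : Partition RS R S) (p₂ : Partition I RS T)
               (q₁ : Partition ST S T) (q₂ : Partition I R ST) →
               ∀ F G H → joinSF p₂ (joinSF p₁ F G) H ≈SF joinSF q₂ F (joinSF q₁ G H)
joinSF-assoc {R = R} {S} {T} p₁ p₂ q₁ q₂ F G H Z =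
    (λ (W , U , (X , Y , mX , mY , W≐) , mU , e) →
       X , Y ∪[ S , T ] U , mX , (Y , U , mY , mU , ≐-refl) ,
       ≐-trans e (∪-assoc p₁ p₂ q₁ q₂ W≐ ≐-refl))
  , (λ (X , V , mX , (Y , U , mY , mU , V≐) , e) →
       X ∪[ R , S ] Y , U , (X , Y , mX , mY , ≐-refl) , mU ,
       ≐-trans e (≐-sym (∪-assoc p₁ p₂ q₁ q₂ ≐-refl V≐)))

restrictSF-restrictSF : ∀ {I R S T RS ST}
                        (p₁ : Partition RS R S) (p₂ : Partition I RS T) (q : Partition I R ST) →
                        ∀ F → restrictSF p₁ (restrictSF p₂ F) ≈SF restrictSF q F
restrictSF-restrictSF {R = R} {RS = RS} p₁ p₂ q F Z = forward , backward
  where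
  open ≐-Reasoning R
  forward : mem (restrictSF p₁ (restrictSF p₂ F)) Z → mem (restrictSF q F) Z
  forward (V , (X , m , V≐) , Z≐) = X , m , (begin
    Z             ≈⟨ Z≐ ⟩
    V ∩[ R ]      ≈⟨ ∩-≐ V ⟩
    V             ≈⟨ ≐-mono (S⊆I p₁) V≐ ⟩
    X ∩[ RS ]     ≈⟨ ≐-mono (S⊆I p₁) (∩-≐ X) ⟩
    X             ≈⟨ ∩-≐ X ⟨
    X ∩[ R ]      ∎)
  backward : mem (restrictSF q F) Z → mem (restrictSF p₁ (restrictSF p₂ F)) Z
  backward (X , m , Z≐) = X ∩[ RS ] , (X , m , ≐-refl) , (begin
    Z               ≈⟨ Z≐ ⟩
    X ∩[ R ]        ≈⟨ ∩-≐ X ⟩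
    X               ≈⟨ ≐-mono (S⊆I p₁) (∩-≐ X) ⟨
    X ∩[ RS ]       ≈⟨ ∩-≐ (X ∩[ RS ]) ⟨
    X ∩[ RS ] ∩[ R ] ∎)

contractSF-restrictSF : ∀ {I R S T RS ST}
                        (p₁ : Partition RS R S) (p₂ : Partition I RS T)
                        (q₁ : Partition ST S T) (q₂ : Partition I R ST) →
                        ∀ F → contractSF p₁ (restrictSF p₂ F) ≈SF restrictSF q₁ (contractSF q₂ F)
contractSF-restrictSF {R = R} {S} {RS = RS} p₁ p₂ q₁ q₂ F Z = forward , backward
  where
  forward : mem (contractSF p₁ (restrictSF p₂ F)) Z → mem (restrictSF q₁ (contractSF q₂ F)) Z
  forward (V , (X , m , V≐) , V≐∅ , Z≐) =
    X , (X , m , ≐-trans (≐-sym (≐-mono (S⊆I p₁) V≐X)) V≐∅ , ≐-refl) ,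
    ≐-trans Z≐ (≐-trans (≐-mono (T⊆I p₁) V≐X) (≐-sym (∩-≐ X)))
    where
    V≐X : V ≐[ RS ] X
    V≐X = ≐-trans V≐ (∩-≐ X)
  backward : mem (restrictSF q₁ (contractSF q₂ F)) Z → mem (contractSF p₁ (restrictSF p₂ F)) Z
  backward (U , (X , m , X≐∅ , U≐) , Z≐) =
    X ∩[ RS ] , (X , m , ≐-refl) ,
    ≐-trans (≐-mono (S⊆I p₁) (∩-≐ X)) X≐∅ ,
    ≐-trans Z≐ (≐-trans (∩-≐ U) (≐-trans (≐-mono (S⊆I q₁) U≐) (≐-sym (≐-mono (T⊆I p₁) (∩-≐ X)))))

contractSF-contractSF : ∀ {I R S T RS ST}
                        (p₁ : Partition RS R S) (p₂ : Partition I RS T)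
                        (q₁ : Partition ST S T) (q₂ : Partition I R ST) →
                        ∀ F → contractSF p₂ F ≈SF contractSF q₁ (contractSF q₂ F)
contractSF-contractSF p₁ p₂ q₁ q₂ F Z =
    (λ (X , m , X≐∅ , Z≐) →
       X , (X , m , ≐-mono (S⊆I p₁) X≐∅ , ≐-refl) , ≐-mono (T⊆I p₁) X≐∅ , Z≐)
  , (λ (U , (X , m , X≐∅ , U≐) , U≐∅ , Z≐) →
       X , m , ≐-by-parts p₁ X≐∅ (≐-trans (≐-sym (≐-mono (S⊆I q₁) U≐)) U≐∅) ,
       ≐-trans Z≐ (≐-mono (T⊆I q₁) U≐))

module _ {I S T S' T' A B C D}
         (P : Partition I S T) (P' : Partition I S' T')
         (pS : Partition S A B) (pT : Partition T C D)
         (pS' : Partition S' A C) (pT' : Partition T' B D) where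

  restrictSF-joinSF : ∀ F G → restrictSF P' (joinSF P F G) ≈SF
                              joinSF pS' (restrictSF pS F) (restrictSF pT G)
  restrictSF-joinSF F G Z =
      (λ (W , (X , Y , mX , mY , W≐) , Z≐) →
         X , Y , (X , mX , ≐-sym (∩-≐ X)) , (Y , mY , ≐-sym (∩-≐ Y)) ,
         ≐-trans Z≐ (≐-trans (∩-≐ W) (≐-trans (≐-mono (S⊆I P') W≐) (refineS' X Y))))
    , (λ (X' , Y' , (X , mX , X'≐) , (Y , mY , Y'≐) , Z≐) →
         X ∪[ S , T ] Y , (X , Y , mX , mY , ≐-refl) ,
         ≐-trans Z≐ (≐-trans (∪-resp-≐ (≐-trans X'≐ (∩-≐ X)) (≐-trans Y'≐ (∩-≐ Y)))
                    (≐-trans (≐-sym (refineS' X Y)) (≐-sym (∩-≐ (X ∪[ S , T ] Y))))))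
    where
    refineS' : ∀ X Y → X ∪[ S , T ] Y ≐[ S' ] X ∪[ A , C ] Y
    refineS' = ∪-refine P pS' (S⊆I pS) (S⊆I pT)

  contractSF-joinSF : ∀ F G → contractSF P' (joinSF P F G) ≈SF
                              joinSF pT' (contractSF pS F) (contractSF pT G)
  contractSF-joinSF F G Z = forward , backward
    where
    refineS' : ∀ X Y → X ∪[ S , T ] Y ≐[ S' ] X ∪[ A , C ] Y
    refineS' = ∪-refine P pS' (S⊆I pS) (S⊆I pT)
    refineT' : ∀ X Y → X ∪[ S , T ] Y ≐[ T' ] X ∪[ B , D ] Y
    refineT' = ∪-refine P pT' (T⊆I pS) (T⊆I pT)

    forward : mem (contractSF P' (joinSF P F G)) Z →
              mem (joinSF pT' (contractSF pS F) (contractSF pT G)) Z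
    forward (W , (X , Y , mX , mY , W≐) , W≐∅ , Z≐) =
      X , Y ,
      (X , mX , ≐-trans (≐-sym (∪-≐ˡ pS' X Y)) (≐-mono (S⊆I pS') X∪Y≐∅) , ≐-refl) ,
      (Y , mY , ≐-trans (≐-sym (∪-≐ʳ pS' X Y)) (≐-mono (T⊆I pS') X∪Y≐∅) , ≐-refl) ,
      ≐-trans Z≐ (≐-trans (≐-mono (T⊆I P') W≐) (refineT' X Y))
      where
      X∪Y≐∅ : X ∪[ A , C ] Y ≐[ S' ] ∅ₛ
      X∪Y≐∅ = ≐-trans (≐-sym (refineS' X Y)) (≐-trans (≐-sym (≐-mono (S⊆I P') W≐)) W≐∅)

    backward : mem (joinSF pT' (contractSF pS F) (contractSF pT G)) Z →
               mem (contractSF P' (joinSF P F G)) Z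
    backward (X' , Y' , (X , mX , X≐∅ , X'≐) , (Y , mY , Y≐∅ , Y'≐) , Z≐) =
      X ∪[ S , T ] Y , (X , Y , mX , mY , ≐-refl) ,
      ≐-trans (refineS' X Y)
              (≐-by-parts pS' (≐-trans (∪-≐ˡ pS' X Y) X≐∅) (≐-trans (∪-≐ʳ pS' X Y) Y≐∅)) ,
      ≐-trans Z≐ (≐-trans (∪-resp-≐ X'≐ Y'≐) (≐-sym (refineT' X Y)))

module _ {I S T J S' T'} (p : Partition I S T) (p' : Partition J S' T')
         (σ : Bij I J) (σS : Bij S S') (σT : Bij T T')
         (agreeS : ∀ i → i ∈ S → to σS i ≡ to σ i)
         (agreeT : ∀ i → i ∈ T → to σT i ≡ to σ i) where

  private
    module AS = Agreement σ σS (S⊆I p) agreeS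
    module AT = Agreement σ σT (T⊆I p) agreeT

  ∪-∘from : ∀ X Y → ((X ∪[ S , T ] Y) ∘ from σ) ≐[ J ] (X ∘ from σS) ∪[ S' , T' ] (Y ∘ from σT)
  ∪-∘from X Y = ≐-by-parts p'
    (≐-trans (≐-sym (AS.transport-≐ (≐-sym (∪-≐ˡ p X Y)))) (≐-sym (∪-≐ˡ p' (X ∘ from σS) (Y ∘ from σT))))
    (≐-trans (≐-sym (AT.transport-≐ (≐-sym (∪-≐ʳ p X Y)))) (≐-sym (∪-≐ʳ p' (X ∘ from σS) (Y ∘ from σT))))

  relabelSF-joinSF : ∀ F G → relabelSF σ (joinSF p F G) ≈SF
                             joinSF p' (relabelSF σS F) (relabelSF σT G)
  relabelSF-joinSF F G Z =
      (λ (W , (X , Y , mX , mY , W≐) , Z≐) →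
         X ∘ from σS , Y ∘ from σT , (X , mX , ≐-refl) , (Y , mY , ≐-refl) ,
         ≐-trans Z≐ (≐-trans (∘from-resp-≐ σ W≐) (∪-∘from X Y)))
    , (λ (X' , Y' , (X , mX , X'≐) , (Y , mY , Y'≐) , Z≐) →
         X ∪[ S , T ] Y , (X , Y , mX , mY , ≐-refl) ,
         ≐-trans Z≐ (≐-trans (∪-resp-≐ X'≐ Y'≐) (≐-sym (∪-∘from X Y))))

  relabelSF-restrictSF : ∀ F → relabelSF σS (restrictSF p F) ≈SF restrictSF p' (relabelSF σ F)
  relabelSF-restrictSF F Z =
      (λ (V , (X , m , V≐) , Z≐) →
         X ∘ from σ , (X , m , ≐-refl) ,
         ≐-trans Z≐ (≐-trans (AS.transport-≐ (≐-trans V≐ (∩-≐ X))) (≐-sym (∩-≐ (X ∘ from σ)))))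
    , (λ (W , (X , m , W≐) , Z≐) →
         X ∩[ S ] , (X , m , ≐-refl) ,
         ≐-trans Z≐ (≐-trans (∩-≐ W) (≐-trans (≐-mono (S⊆I p') W≐) (≐-sym (AS.transport-≐ (∩-≐ X))))))

  relabelSF-contractSF : ∀ F → relabelSF σT (contractSF p F) ≈SF contractSF p' (relabelSF σ F)
  relabelSF-contractSF F Z =
      (λ (V , (X , m , X≐∅ , V≐) , Z≐) →
         X ∘ from σ , (X , m , ≐-refl) ,
         ≐-sym (AS.transport-≐ (≐-sym X≐∅)) ,
         ≐-trans Z≐ (AT.transport-≐ V≐))
    , (λ (W , (X , m , W≐) , W≐∅ , Z≐) →
         X , (X , m , AS.transport-reflects-≐ (≐-trans (≐-sym (≐-mono (S⊆I p') W≐)) W≐∅) , ≐-refl) ,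
         ≐-trans Z≐ (≐-trans (≐-mono (T⊆I p') W≐) (≐-sym (AT.transport-≐ {X} ≐-refl))))

SF-isHopfMonoid : IsHopfMonoid SF μSF ΔSF unitSF
SF-isHopfMonoid = record
  { μ-cong    = joinSF-cong
  ; Δ-cong    = λ p q {F} {F'} F≈F' → restrictSF-cong p q {F} {F'} F≈F'
                                  , contractSF-cong p q {F} {F'} F≈F'
  ; μ-natural = relabelSF-joinSF
  ; Δ-natural = λ p p' σ σS σT agreeS agreeT F →
                  relabelSF-restrictSF p p' σ σS σT agreeS agreeT F
                , relabelSF-contractSF p p' σ σS σT agreeS agreeT F
  ; unitʳ     = joinSF-identityʳ
  ; unitˡ     = joinSF-identityˡ
  ; counitʳ   = restrictSF-identity
  ; counitˡ   = contractSF-identity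
  ; assoc     = joinSF-assoc
  ; coassoc   = λ p₁ p₂ q₁ q₂ F → restrictSF-restrictSF p₁ p₂ q₂ F
                                , contractSF-restrictSF p₁ p₂ q₁ q₂ F
                                , contractSF-contractSF p₁ p₂ q₁ q₂ F
  ; compat    = λ P P' pS pT pS' pT' F G → restrictSF-joinSF P P' pS pT pS' pT' F G
                                         , contractSF-joinSF P P' pS pT pS' pT' F G
  }

theorem3p3 : IsSetSpecies SF × IsConnected SF × IsCommutative SF μSF
             × Σ (SetSpecies.H SF []) (λ e → IsHopfMonoid SF μSF ΔSF e)
theorem3p3 = SF-isSetSpecies , SF-connected , joinSF-comm , unitSF , SF-isHopfMonoid
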